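{- Let $\vec{c}=(c_1,\dots,c_k)$ be a pointed composition of $n$ with $c_k=0$. Then the simplicial complex $\Delta_{\vec{c}}$ is shellable.
   Context: A pointed composition of $n$ is a sequence $(c_1,\dots,c_k)$ of integers with $c_1,\dots,c_{k-1}\ge 1$, $c_k\ge 0$ and sum $n$. They are partially ordered by $\vec c\le\vec d$ iff $\vec d$ is obtained from $\vec c$ by replacing runs of consecutive entries by their sums. An ordered set partition of $[n]$ is a list $(C_1,\dots,C_m)$ of pairwise disjoint subsets of $[n]$ with union $[n]$, with $C_1,\dots,C_{m-1}$ nonempty ($C_m$ may be empty); its type is $(|C_1|,\dots,|C_m|)$. The simplicial complex $\Delta_n$ has these as faces: $(C_1,\dots,C_m)$ has dimension $m-2$, its faces are obtained by merging consecutive blocks, and $([n])$ is the empty face (equivalently, $\Delta_n$ is the order complex of the poset of nonempty subsets of $[n]$, the chain $S_1\subset\dots\subset S_{m-1}$ corresponding to $(S_1,S_2\setminus S_1,\dots,[n]\setminus S_{m-1})$). Let $\Delta_{\vec c}=\{\tau\in\Delta_n:\vec c\le\operatorname{type}(\tau)\}$. A pure simplicial complex is shellable if it is a set of points or its facets can be ordered $F_1,\dots,F_m$ so that for $i\ge2$, $F_i\cap(F_1\cup\dots\cup F_{i-1})$ is pure of dimension $\dim F_i-1$. -}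

module Defs where

open import Data.Nat using (ℕ; _≤_; _<_)
open import Data.Integer using (ℤ; +_; _-_) renaming (_≤_ to _≤ℤ_)
open import Data.Fin using (Fin; toℕ)
open import Data.Fin.Subset using (Subset; _∩_; ⋃; ⊤; Nonempty; Empty)
open import Data.List using (List; []; _∷_; [_]; _++_; concat; map; length)
open import Data.Nat.ListAction using (sum)
open import Data.List.Relation.Unary.All using (All)
open import Data.List.Relation.Unary.AllPairs using (AllPairs)
open import Data.Product using (Σ; ∃; _×_; _,_)
open import Data.Sum using (_⊎_)
open import Relation.Binary.PropositionalEquality using (_≡_)

NonEmptyList : {A : Set} → List A → Set
NonEmptyList {A} xs = Σ A λ y → Σ (List A) λ ys → xs ≡ y ∷ ys

Merges : {A : Set} → (List A → A) → List A → List A → Set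
Merges {A} f xs ys =
  Σ (List (List A)) λ L → All NonEmptyList L × concat L ≡ xs × map f L ≡ ys

IsPointedComposition : ℕ → List ℕ → Set
IsPointedComposition n c =
  Σ (List ℕ) λ cs → Σ ℕ λ ck →
    c ≡ cs ++ [ ck ] × All (1 ≤_) cs × sum c ≡ n

_≤c_ : List ℕ → List ℕ → Set
c ≤c d = Merges sum c d

-- Ordered set partitions of [n] = faces of Δₙ

IsOSP : (n : ℕ) → List (Subset n) → Set
IsOSP n bs =
  Σ (List (Subset n)) λ cs → Σ (Subset n) λ cm →
    bs ≡ cs ++ [ cm ] × All Nonempty cs
    × AllPairs (λ A B → Empty (A ∩ B)) bs × ⋃ bs ≡ ⊤

type : {n : ℕ} → List (Subset n) → List ℕ
type = map Data.Fin.Subset.∣_∣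

dim : {n : ℕ} → List (Subset n) → ℤ
dim bs = + length bs - + 2

_≼_ : {n : ℕ} → List (Subset n) → List (Subset n) → Set
τ ≼ σ = Merges ⋃ σ τ

Complex : ℕ → Set₁
Complex n = List (Subset n) → Set

Δ : (n : ℕ) → Complex n
Δ n τ = IsOSP n τ

Δ[_] : {n : ℕ} → List ℕ → Complex n
Δ[_] {n} c τ = IsOSP n τ × c ≤c type τ

Facet : {n : ℕ} → Complex n → List (Subset n) → Set
Facet K F = K F × (∀ G → K G → F ≼ G → G ≡ F)

PureOfDim : {n : ℕ} → Complex n → ℤ → Set
PureOfDim K d = ∀ F → Facet K F → dim F ≡ d

Pure : {n : ℕ} → Complex n → Set
Pure K = ∃ λ d → PureOfDim K d

SetOfPoints : {n : ℕ} → Complex n → Set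
SetOfPoints K = ∀ τ → K τ → dim τ ≤ℤ + 0

ShellInter : {n m : ℕ} → (Fin m → List (Subset n)) → Fin m → Complex n
ShellInter F i τ = τ ≼ F i × ∃ λ j → toℕ j < toℕ i × τ ≼ F j

IsShelling : {n : ℕ} → Complex n → (m : ℕ) → (Fin m → List (Subset n)) → Set
IsShelling K m F =
    (∀ i → Facet K (F i))
  × (∀ G → Facet K G → ∃ λ i → F i ≡ G)
  × (∀ i j → F i ≡ F j → i ≡ j)
  × (∀ i → 1 ≤ toℕ i → PureOfDim (ShellInter F i) (dim (F i) - + 1))

Shellable : {n : ℕ} → Complex n → Set
Shellable {n} K =
  Pure K × (SetOfPoints K ⊎ Σ ℕ λ m → Σ (Fin m → List (Subset n)) λ F → IsShelling K m F)

module Submission where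

-- We prove that Δ_c is shellable whenever c = cs ++ [ z ] with all entries
-- of cs positive, i.e. for every pointed composition.
--
-- 1. Subsets and lists of blocks: disjointness, sizes, blocks by position.
-- 2. The facets of Δ_c are exactly the "full" partitions (ordered set
--    partitions of type exactly c): every face refines to one by splitting
--    its blocks, and full partitions are maximal.  They are enumerated
--    without repetition in increasing lexicographic order (blocks compared
--    as bit vectors with 1 < 0).
-- 3. Let F′ < F be full and τ a common face.  The first block where they
--    differ yields an element x lying before some cut l in F′ but after it
--    in F, where F has a descent a ∈ F_l, b ∈ F_{l+1}, b < a.  Since c has
--    no inner zeros its decomposition into runs is unique, so τ merges the
--    blocks l, l+1 of F.  Exchanging a and b gives a full G < F with the
--    same merge, so the merge of F at l lies in an earlier facet and τ is
--    this ridge: every maximal face of F ∩ (earlier facets) has codimension 1.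
-- 4. The corollary follows by taking the facets in lexicographic order.

open import Data.Nat as ℕ using (ℕ; zero; suc; _+_; _∸_; _≤_; _<_; z≤n; s≤s)
import Data.Nat.Properties as NP
open import Data.Nat.ListAction using (sum)
open import Data.Integer using (ℤ; +_; _-_) renaming (_+_ to _+ℤ_)
open import Data.Integer.Tactic.RingSolver using (solve-∀)
open import Data.Bool as B using (Bool; true; false; _∨_)
open import Data.Fin as Fin using (Fin; zero; suc; toℕ)
import Data.Fin.Properties as FP
open import Data.Fin.Subset using (Subset; _∈_; _∉_; _⊆_; _∪_; _∩_; _─_; ⊥; ⊤; ⋃; ∣_∣; Empty; Nonempty)
open import Data.Fin.Subset.Properties
  using (∉⊥; ∈⊤; drop-∷-⊆; p─q⊆p; x∈p∩q⁺; x∈p∩q⁻; x∈p∪q⁺; x∈p∪q⁻;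
         drop-∷-Empty; Empty-unique; nonempty?; _∈?_; ∣⊥∣≡0; ∪-assoc; ∪-identityˡ; ∪-identityʳ;
         p⊂q⇒∣p∣<∣q∣)
open import Data.Vec as V using ([]; _∷_; here; there; lookup; _[_]≔_)
import Data.Vec.Properties as VP
open import Data.List as L using (List; []; _∷_; _++_; length; take; map; concat; [_]; last)
import Data.List.Properties as LP
open import Data.List.Relation.Unary.All as All using (All; []; _∷_)
import Data.List.Relation.Unary.All.Properties as AllP
open import Data.List.Relation.Unary.AllPairs as AP using (AllPairs; []; _∷_)
import Data.List.Relation.Unary.AllPairs.Properties as APP
open import Data.List.Relation.Unary.Any as Any using (here; there)
import Data.List.Relation.Unary.Any.Properties as AnyP
import Data.List.Membership.Propositional as Mem
import Data.List.Membership.Propositional.Properties as MemP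
open import Data.Maybe using (just)
open import Data.Product using (∃; _×_; _,_; proj₁; proj₂)
open import Data.Sum using (inj₁; inj₂)
open import Data.Empty using (⊥-elim) renaming (⊥ to Void)
open import Relation.Nullary using (¬_; yes; no; Dec)
open import Relation.Nullary.Decidable.Core using (_×-dec_)
open import Relation.Binary.Definitions using (tri<; tri≈; tri>)
open import Relation.Binary.PropositionalEquality hiding ([_])
open import Defs

private variable
  n : ℕ

∈⇒lookup : {p : Subset n} {x : Fin n} → x ∈ p → lookup p x ≡ true
∈⇒lookup = VP.[]=⇒lookup

lookup⇒∈ : {p : Subset n} {x : Fin n} → lookup p x ≡ true → x ∈ p
lookup⇒∈ {p = p} {x} = VP.lookup⇒[]= x p

∉⇒lookup : {p : Subset n} {x : Fin n} → x ∉ p → lookup p x ≡ false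
∉⇒lookup {p = p} {x} x∉p with lookup p x in eq
... | true  = ⊥-elim (x∉p (lookup⇒∈ eq))
... | false = refl

subset-ext : {u v : Subset n} → (∀ i → lookup u i ≡ lookup v i) → u ≡ v
subset-ext {u = []}    {[]}    f = refl
subset-ext {u = a ∷ u} {b ∷ v} f = cong₂ _∷_ (f zero) (subset-ext (λ i → f (suc i)))

Disjoint : Subset n → Subset n → Set
Disjoint A B = Empty (A ∩ B)

disjoint-elim : {A B : Subset n} {x : Fin n} → Disjoint A B → x ∈ A → x ∈ B → Void
disjoint-elim {x = x} d x∈A x∈B = d (x , x∈p∩q⁺ (x∈A , x∈B))

disjoint-intro : {A B : Subset n} → (∀ {x} → x ∈ A → x ∈ B → Void) → Disjoint A B
disjoint-intro {A = A} {B} f (x , x∈A∩B) = let (x∈A , x∈B) = x∈p∩q⁻ A B x∈A∩B in f x∈A x∈B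

disjoint? : (A B : Subset n) → Dec (Disjoint A B)
disjoint? A B with nonempty? (A ∩ B)
... | yes ne = no (λ e → e ne)
... | no e   = yes e

∣∪∣-disjoint : (A B : Subset n) → Disjoint A B → ∣ A ∪ B ∣ ≡ ∣ A ∣ + ∣ B ∣
∣∪∣-disjoint []          []          d = refl
∣∪∣-disjoint (true ∷ A)  (true ∷ B)  d = ⊥-elim (d (zero , here))
∣∪∣-disjoint (true ∷ A)  (false ∷ B) d = cong suc (∣∪∣-disjoint A B (drop-∷-Empty d))
∣∪∣-disjoint (false ∷ A) (true ∷ B)  d =
  trans (cong suc (∣∪∣-disjoint A B (drop-∷-Empty d))) (sym (NP.+-suc ∣ A ∣ ∣ B ∣))
∣∪∣-disjoint (false ∷ A) (false ∷ B) d = ∣∪∣-disjoint A B (drop-∷-Empty d)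

∣p∣≡0⇒p≡⊥ : (D : Subset n) → ∣ D ∣ ≡ 0 → D ≡ ⊥
∣p∣≡0⇒p≡⊥ []          e = refl
∣p∣≡0⇒p≡⊥ (false ∷ D) e = cong (false ∷_) (∣p∣≡0⇒p≡⊥ D e)

1≤∣p∣⇒nonempty : (p : Subset n) → 1 ≤ ∣ p ∣ → Nonempty p
1≤∣p∣⇒nonempty {n} p 1≤∣p∣ with nonempty? p
... | yes ne = ne
... | no e with Empty-unique e
... | refl = ⊥-elim (NP.<-irrefl (sym (∣⊥∣≡0 n)) 1≤∣p∣)

-- Blocks of an ordered partition, accessed by position (⊥ past the end).
blk : List (Subset n) → ℕ → Subset n
blk []      _       = ⊥
blk (B ∷ _) zero    = B
blk (_ ∷ F) (suc s) = blk F s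

∈⋃⁺ : (F : List (Subset n)) (s : ℕ) {x : Fin n} → x ∈ blk F s → x ∈ ⋃ F
∈⋃⁺ []      s       x∈ = ⊥-elim (∉⊥ x∈)
∈⋃⁺ (B ∷ F) zero    x∈ = x∈p∪q⁺ (inj₁ x∈)
∈⋃⁺ (B ∷ F) (suc s) x∈ = x∈p∪q⁺ (inj₂ (∈⋃⁺ F s x∈))

∈⋃⁻ : (F : List (Subset n)) {x : Fin n} → x ∈ ⋃ F → ∃ λ s → s < length F × x ∈ blk F s
∈⋃⁻ []      x∈ = ⊥-elim (∉⊥ x∈)
∈⋃⁻ (B ∷ F) x∈ with x∈p∪q⁻ B (⋃ F) x∈
... | inj₁ x∈B = zero , s≤s z≤n , x∈B
... | inj₂ x∈F with ∈⋃⁻ F x∈F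
... | s , s<len , x∈s = suc s , s≤s s<len , x∈s

blk-in-range : (F : List (Subset n)) (s : ℕ) {x : Fin n} → x ∈ blk F s → s < length F
blk-in-range []      s       x∈ = ⊥-elim (∉⊥ x∈)
blk-in-range (B ∷ F) zero    x∈ = s≤s z≤n
blk-in-range (B ∷ F) (suc s) x∈ = s≤s (blk-in-range F s x∈)

All-blk : {P : Subset n → Set} {F : List (Subset n)} → All P F → (s : ℕ) → s < length F → P (blk F s)
All-blk (p ∷ ps) zero    _         = p
All-blk (p ∷ ps) (suc s) (s≤s lt) = All-blk ps s lt

All-from-blk : {P : Subset n → Set} (F : List (Subset n)) → ((s : ℕ) → s < length F → P (blk F s)) → All P F
All-from-blk []      f = []
All-from-blk (B ∷ F) f = f zero (s≤s z≤n) ∷ All-from-blk F (λ s lt → f (suc s) (s≤s lt))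

cover-blk : (F : List (Subset n)) → ⋃ F ≡ ⊤ → ∀ x → ∃ λ s → s < length F × x ∈ blk F s
cover-blk F un x = ∈⋃⁻ F (subst (x ∈_) (sym un) ∈⊤)

entry : List ℕ → ℕ → ℕ
entry []      _       = 0
entry (x ∷ c) zero    = x
entry (x ∷ c) (suc s) = entry c s

∣blk∣ : (F : List (Subset n)) (s : ℕ) → ∣ blk F s ∣ ≡ entry (type F) s
∣blk∣ {n} []      s       = ∣⊥∣≡0 n
∣blk∣     (B ∷ F) zero    = refl
∣blk∣     (B ∷ F) (suc s) = ∣blk∣ F s

BlocksDisjoint : List (Subset n) → Set
BlocksDisjoint {n} F = ∀ s s' {x : Fin n} → x ∈ blk F s → x ∈ blk F s' → s ≡ s'

AllPairs⇒BlocksDisjoint : {F : List (Subset n)} → AllPairs Disjoint F → BlocksDisjoint F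
AllPairs⇒BlocksDisjoint [] s s' x∈ _ = ⊥-elim (∉⊥ x∈)
AllPairs⇒BlocksDisjoint (d ∷ ds) zero zero _ _ = refl
AllPairs⇒BlocksDisjoint {F = B ∷ F} (d ∷ ds) zero (suc s') x∈ x∈' =
  ⊥-elim (disjoint-elim (All-blk d s' (blk-in-range F s' x∈')) x∈ x∈')
AllPairs⇒BlocksDisjoint {F = B ∷ F} (d ∷ ds) (suc s) zero x∈ x∈' =
  ⊥-elim (disjoint-elim (All-blk d s (blk-in-range F s x∈)) x∈' x∈)
AllPairs⇒BlocksDisjoint (d ∷ ds) (suc s) (suc s') x∈ x∈' = cong suc (AllPairs⇒BlocksDisjoint ds s s' x∈ x∈')

BlocksDisjoint⇒AllPairs : (F : List (Subset n)) → BlocksDisjoint F → AllPairs Disjoint F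
BlocksDisjoint⇒AllPairs []      bd = []
BlocksDisjoint⇒AllPairs (B ∷ F) bd =
  All-from-blk F (λ s _ → disjoint-intro (λ x∈B x∈s → NP.0≢1+n (bd zero (suc s) x∈B x∈s)))
  ∷ BlocksDisjoint⇒AllPairs F (λ s s' x∈ x∈' → NP.suc-injective (bd (suc s) (suc s') x∈ x∈'))

⋃-++ : (xs ys : List (Subset n)) → ⋃ (xs ++ ys) ≡ ⋃ xs ∪ ⋃ ys
⋃-++ []       ys = sym (∪-identityˡ (⋃ ys))
⋃-++ (x ∷ xs) ys = trans (cong (x ∪_) (⋃-++ xs ys)) (sym (∪-assoc x (⋃ xs) (⋃ ys)))

⋃-concat : (LL : List (List (Subset n))) → ⋃ (concat LL) ≡ ⋃ (map ⋃ LL)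
⋃-concat []       = refl
⋃-concat (X ∷ LL) = trans (⋃-++ X (concat LL)) (cong (⋃ X ∪_) (⋃-concat LL))

take-blk : (m s : ℕ) (F : List (Subset n)) → s < m → blk (take m F) s ≡ blk F s
take-blk (suc m) zero    []      _        = refl
take-blk (suc m) zero    (B ∷ F) _        = refl
take-blk (suc m) (suc s) []      _        = refl
take-blk (suc m) (suc s) (B ∷ F) (s≤s lt) = take-blk m s F lt

∈⋃-take⁻ : (m : ℕ) (F : List (Subset n)) {x : Fin n} → x ∈ ⋃ (take m F) → ∃ λ s → s < m × x ∈ blk F s
∈⋃-take⁻ m F x∈ with ∈⋃⁻ (take m F) x∈
... | s , s<len , x∈s = s , s<m , subst (_ ∈_) (take-blk m s F s<m) x∈s
  where s<m = NP.<-≤-trans s<len (NP.≤-trans (NP.≤-reflexive (LP.length-take m F)) (NP.m⊓n≤m m _))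

take-++ʳ : {A : Set} (k : ℕ) (R Y : List A) → take (length R + k) (R ++ Y) ≡ R ++ take k Y
take-++ʳ k []      Y = refl
take-++ʳ k (a ∷ R) Y = cong (a ∷_) (take-++ʳ k R Y)

take-length-++ : {A : Set} (R Y : List A) → take (length R) (R ++ Y) ≡ R
take-length-++ []      Y = refl
take-length-++ (a ∷ R) Y = cong (a ∷_) (take-length-++ R Y)

data _<S_ : Subset n → Subset n → Set where
  here  : {p q : Subset n} → (true ∷ p) <S (false ∷ q)
  there : {b : Bool} {p q : Subset n} → p <S q → (b ∷ p) <S (b ∷ q)

data _<L_ : List (Subset n) → List (Subset n) → Set where
  here  : {a b : Subset n} {as bs : List (Subset n)} → a <S b → (a ∷ as) <L (b ∷ bs)
  there : {a : Subset n} {as bs : List (Subset n)} → as <L bs → (a ∷ as) <L (a ∷ bs)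

<S-irrefl : {p : Subset n} → ¬ p <S p
<S-irrefl (there h) = <S-irrefl h

<S-asym : {p q : Subset n} → p <S q → ¬ q <S p
<S-asym here      ()
<S-asym (there h) (there h') = <S-asym h h'

<L-irrefl : {F : List (Subset n)} → ¬ F <L F
<L-irrefl (here h)  = <S-irrefl h
<L-irrefl (there h) = <L-irrefl h

<L-asym : {F G : List (Subset n)} → F <L G → ¬ G <L F
<L-asym (here h)  (here h')  = <S-asym h h'
<L-asym (here h)  (there h') = <S-irrefl h
<L-asym (there h) (here h')  = <S-irrefl h'
<L-asym (there h) (there h') = <L-asym h h'

subsets : (n : ℕ) → List (Subset n)
subsets zero    = [] ∷ []
subsets (suc n) = map (true ∷_) (subsets n) ++ map (false ∷_) (subsets n)

subsets-sorted : (n : ℕ) → AllPairs _<S_ (subsets n)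
subsets-sorted zero    = [] ∷ []
subsets-sorted (suc n) =
  APP.++⁺ (APP.map⁺ (AP.map there (subsets-sorted n))) (APP.map⁺ (AP.map there (subsets-sorted n)))
    (AllP.map⁺ (All.universal (λ _ → AllP.map⁺ (All.universal (λ _ → here) (subsets n))) (subsets n)))

subsets-complete : (p : Subset n) → p Mem.∈ subsets n
subsets-complete []                = here refl
subsets-complete {suc n} (true ∷ p)  = MemP.∈-++⁺ˡ (MemP.∈-map⁺ (true ∷_) (subsets-complete p))
subsets-complete {suc n} (false ∷ p) =
  MemP.∈-++⁺ʳ (map (true ∷_) (subsets n)) (MemP.∈-map⁺ (false ∷_) (subsets-complete p))

block-lists : ℕ → List (List (Subset n))
block-lists zero        = [] ∷ []
block-lists {n} (suc m) = concat (map (λ a → map (a ∷_) (block-lists m)) (subsets n))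

block-lists-sorted : (m : ℕ) → AllPairs _<L_ (block-lists {n} m)
block-lists-sorted zero        = [] ∷ []
block-lists-sorted {n} (suc m) =
  APP.concat⁺ (AllP.map⁺ (All.universal (λ _ → APP.map⁺ (AP.map there (block-lists-sorted m))) (subsets n)))
    (APP.map⁺ (AP.map (λ a<b → AllP.map⁺ (All.universal
                                 (λ _ → AllP.map⁺ (All.universal (λ _ → here a<b) (block-lists m)))
                                 (block-lists m)))
                      (subsets-sorted n)))

block-lists-complete : (F : List (Subset n)) → F Mem.∈ block-lists (length F)
block-lists-complete []      = here refl
block-lists-complete (B ∷ F) =
  MemP.∈-concat⁺′ (MemP.∈-map⁺ (B ∷_) (block-lists-complete F))
                  (MemP.∈-map⁺ (λ a → map (a ∷_) (block-lists (length F))) (subsets-complete B))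

Full : List ℕ → List (Subset n) → Set
Full c F = AllPairs Disjoint F × ⋃ F ≡ ⊤ × type F ≡ c

full? : (c : List ℕ) (F : List (Subset n)) → Dec (Full c F)
full? c F = AP.allPairs? disjoint? F ×-dec (VP.≡-dec B._≟_ (⋃ F) ⊤ ×-dec LP.≡-dec ℕ._≟_ (type F) c)

length-full : {c : List ℕ} {F : List (Subset n)} → Full c F → length F ≡ length c
length-full {F = F} (_ , _ , ty) = trans (sym (LP.length-map ∣_∣ F)) (cong length ty)

All-lookup : {A : Set} {P : A → Set} {xs : List A} → All P xs → (i : Fin (length xs)) → P (L.lookup xs i)
All-lookup (p ∷ ps) zero    = p
All-lookup (p ∷ ps) (suc i) = All-lookup ps i

AllPairs-lookup : {A : Set} {R : A → A → Set} {xs : List A} → AllPairs R xs →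
  (i j : Fin (length xs)) → toℕ i < toℕ j → R (L.lookup xs i) (L.lookup xs j)
AllPairs-lookup (r ∷ rs) zero    (suc j) _        = All-lookup r j
AllPairs-lookup (r ∷ rs) (suc i) (suc j) (s≤s lt) = AllPairs-lookup rs i j lt

-- The list of all full partitions of type c, sorted lexicographically.
-- It is kept abstract: only the three properties below are ever used.
abstract
  full-partitions : List ℕ → List (List (Subset n))
  full-partitions c = L.filter (full? c) (block-lists (length c))

  full-partitions-sorted : (c : List ℕ) → AllPairs _<L_ (full-partitions {n} c)
  full-partitions-sorted c = APP.filter⁺ (full? c) (block-lists-sorted (length c))

  full-partitions-complete : (c : List ℕ) (F : List (Subset n)) → Full c F →
    ∃ λ (i : Fin (length (full-partitions {n} c))) → L.lookup (full-partitions c) i ≡ F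
  full-partitions-complete c F full = Any.index F∈ , sym (AnyP.lookup-index F∈)
    where
    F∈ : F Mem.∈ full-partitions c
    F∈ = MemP.∈-filter⁺ (full? c) (subst (λ k → F Mem.∈ block-lists k) (length-full full) (block-lists-complete F)) full

  full-partitions-full : (c : List ℕ) (i : Fin (length (full-partitions {n} c))) → Full c (L.lookup (full-partitions c) i)
  full-partitions-full c = All-lookup (AllP.all-filter (full? c) (block-lists (length c)))

module _ {A : Set} where

  singletons : List A → List (List A)
  singletons = map [_]

  singletons-nonempty : (xs : List A) → All NonEmptyList (singletons xs)
  singletons-nonempty []       = []
  singletons-nonempty (x ∷ xs) = (x , [] , refl) ∷ singletons-nonempty xs

  map-singletons : (f : List A → A) → (∀ x → f [ x ] ≡ x) → (xs : List A) → map f (singletons xs) ≡ xs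
  map-singletons f f[x]≡x []       = refl
  map-singletons f f[x]≡x (x ∷ xs) = cong₂ _∷_ (f[x]≡x x) (map-singletons f f[x]≡x xs)

  Merges-refl : (f : List A → A) → (∀ x → f [ x ] ≡ x) → (xs : List A) → Merges f xs xs
  Merges-refl f f[x]≡x xs =
    singletons xs , singletons-nonempty xs , LP.concat-map-[ xs ] , map-singletons f f[x]≡x xs

  length-runs : (L : List (List A)) → All NonEmptyList L → length L ≤ length (concat L)
  length-runs []             []                     = z≤n
  length-runs ((x ∷ r) ∷ L) ((_ , _ , refl) ∷ nes) =
    s≤s (NP.≤-trans (length-runs L nes)
                    (subst (length (concat L) ≤_) (sym (LP.length-++ r)) (NP.m≤n+m _ (length r))))

  runs-singletons : (L : List (List A)) → All NonEmptyList L → length (concat L) ≤ length L →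
    L ≡ singletons (concat L)
  runs-singletons []                 []        _        = refl
  runs-singletons ((x ∷ []) ∷ L)     (_ ∷ nes) (s≤s h) = cong ([ x ] ∷_) (runs-singletons L nes h)
  runs-singletons ((x ∷ y ∷ r) ∷ L) (_ ∷ nes) (s≤s h) =
    ⊥-elim (NP.<-irrefl refl (NP.≤-trans too-long (NP.≤-trans (length-runs L nes) (NP.m≤n+m _ (length r)))))
    where
    too-long : suc (length r + length (concat L)) ≤ length L
    too-long = subst (λ k → suc k ≤ length L) (LP.length-++ r) h

  Merges-length : {f : List A → A} {xs ys : List A} → Merges f xs ys → length ys ≤ length xs
  Merges-length {f} (L , nes , refl , refl) =
    subst (_≤ length (concat L)) (sym (LP.length-map f L)) (length-runs L nes)

  Merges-same-length : {f : List A → A} → (∀ x → f [ x ] ≡ x) → {xs ys : List A} →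
    Merges f xs ys → length xs ≤ length ys → ys ≡ xs
  Merges-same-length {f} f[x]≡x (L , nes , refl , refl) h = begin
    map f L                           ≡⟨ cong (map f) (runs-singletons L nes h′) ⟩
    map f (singletons (concat L))     ≡⟨ map-singletons f f[x]≡x (concat L) ⟩
    concat L                          ∎
    where
    open ≡-Reasoning
    h′ : length (concat L) ≤ length L
    h′ = subst (length (concat L) ≤_) (LP.length-map f L) h

⋃-singleton : (B : Subset n) → ⋃ [ B ] ≡ B
⋃-singleton = ∪-identityʳ

sum-singleton : (x : ℕ) → sum [ x ] ≡ x
sum-singleton = NP.+-identityʳ

≼-refl : (F : List (Subset n)) → F ≼ F
≼-refl = Merges-refl ⋃ ⋃-singleton

≤c-refl : (c : List ℕ) → c ≤c c
≤c-refl = Merges-refl sum sum-singleton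

-- The a smallest elements of D (a ≤ ∣ D ∣ in all uses).
smallest : ℕ → Subset n → Subset n
smallest a       []          = []
smallest zero    (b ∷ D)     = false ∷ ⊥
smallest (suc a) (true ∷ D)  = true ∷ smallest a D
smallest (suc a) (false ∷ D) = false ∷ smallest (suc a) D

smallest⊆ : (a : ℕ) (D : Subset n) → smallest a D ⊆ D
smallest⊆ zero    (b ∷ D)     (there x∈) = ⊥-elim (∉⊥ x∈)
smallest⊆ (suc a) (true ∷ D)  here       = here
smallest⊆ (suc a) (true ∷ D)  (there x∈) = there (smallest⊆ a D x∈)
smallest⊆ (suc a) (false ∷ D) (there x∈) = there (smallest⊆ (suc a) D x∈)

∣smallest∣ : (a : ℕ) (D : Subset n) → a ≤ ∣ D ∣ → ∣ smallest a D ∣ ≡ a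
∣smallest∣         zero    []          _       = refl
∣smallest∣ {suc n} zero    (b ∷ D)     _       = ∣⊥∣≡0 n
∣smallest∣         (suc a) (true ∷ D)  (s≤s h) = cong suc (∣smallest∣ a D h)
∣smallest∣         (suc a) (false ∷ D) h       = ∣smallest∣ (suc a) D h

∣─∣+∣∣ : (D f : Subset n) → f ⊆ D → ∣ D ─ f ∣ + ∣ f ∣ ≡ ∣ D ∣
∣─∣+∣∣ []          []          _   = refl
∣─∣+∣∣ (true ∷ D)  (true ∷ f)  f⊆D =
  trans (NP.+-suc ∣ D ─ f ∣ ∣ f ∣) (cong suc (∣─∣+∣∣ D f (drop-∷-⊆ f⊆D)))
∣─∣+∣∣ (true ∷ D)  (false ∷ f) f⊆D = cong suc (∣─∣+∣∣ D f (drop-∷-⊆ f⊆D))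
∣─∣+∣∣ (false ∷ D) (true ∷ f)  f⊆D with f⊆D here
... | ()
∣─∣+∣∣ (false ∷ D) (false ∷ f) f⊆D = ∣─∣+∣∣ D f (drop-∷-⊆ f⊆D)

∉─ : (D f : Subset n) {x : Fin n} → x ∈ f → x ∉ D ─ f
∉─ (d ∷ D) (true ∷ f) here       ()
∉─ (d ∷ D) (b ∷ f)    (there x∈) (there x∈′) = ∉─ D f x∈ x∈′

∪─ : (D f : Subset n) → f ⊆ D → f ∪ (D ─ f) ≡ D
∪─ []          []          _   = refl
∪─ (true ∷ D)  (true ∷ f)  f⊆D = cong (true ∷_) (∪─ D f (drop-∷-⊆ f⊆D))
∪─ (true ∷ D)  (false ∷ f) f⊆D = cong (true ∷_) (∪─ D f (drop-∷-⊆ f⊆D))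
∪─ (false ∷ D) (true ∷ f)  f⊆D with f⊆D here
... | ()
∪─ (false ∷ D) (false ∷ f) f⊆D = cong (false ∷_) (∪─ D f (drop-∷-⊆ f⊆D))

split : List ℕ → Subset n → List (Subset n)
split []      D = []
split (a ∷ r) D = smallest a D ∷ split r (D ─ smallest a D)

split-step : (a : ℕ) (r : List ℕ) (D : Subset n) → a + sum r ≡ ∣ D ∣ →
  sum r ≡ ∣ D ─ smallest a D ∣ × a ≤ ∣ D ∣
split-step {n} a r D e = NP.+-cancelˡ-≡ a (sum r) ∣ rest ∣ (trans e (sym ∣D∣≡a+∣rest∣)) , a≤∣D∣
  where
  open ≡-Reasoning
  rest : Subset n
  rest = D ─ smallest a D
  a≤∣D∣ : a ≤ ∣ D ∣
  a≤∣D∣ = subst (a ≤_) e (NP.m≤m+n a (sum r))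
  ∣D∣≡a+∣rest∣ : a + ∣ rest ∣ ≡ ∣ D ∣
  ∣D∣≡a+∣rest∣ = begin
    a + ∣ rest ∣                  ≡⟨ NP.+-comm a ∣ rest ∣ ⟩
    ∣ rest ∣ + a                  ≡⟨ cong (λ k → ∣ rest ∣ + k) (∣smallest∣ a D a≤∣D∣) ⟨
    ∣ rest ∣ + ∣ smallest a D ∣   ≡⟨ ∣─∣+∣∣ D _ (smallest⊆ a D) ⟩
    ∣ D ∣                         ∎

split-sizes : (r : List ℕ) (D : Subset n) → sum r ≡ ∣ D ∣ → map ∣_∣ (split r D) ≡ r
split-sizes []      D e = refl
split-sizes (a ∷ r) D e =
  let (e′ , a≤∣D∣) = split-step a r D e in cong₂ _∷_ (∣smallest∣ a D a≤∣D∣) (split-sizes r _ e′)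

split-⋃ : (r : List ℕ) (D : Subset n) → sum r ≡ ∣ D ∣ → ⋃ (split r D) ≡ D
split-⋃ []      D e = sym (∣p∣≡0⇒p≡⊥ D (sym e))
split-⋃ (a ∷ r) D e =
  trans (cong (smallest a D ∪_) (split-⋃ r _ (proj₁ (split-step a r D e)))) (∪─ D _ (smallest⊆ a D))

split-⊆ : (r : List ℕ) (D : Subset n) → All (_⊆ D) (split r D)
split-⊆ []      D = []
split-⊆ (a ∷ r) D = smallest⊆ a D ∷ All.map (λ X⊆ {x} x∈ → p─q⊆p D (smallest a D) (X⊆ x∈)) (split-⊆ r _)

split-disjoint : (r : List ℕ) (D : Subset n) → AllPairs Disjoint (split r D)
split-disjoint []      D = []
split-disjoint (a ∷ r) D =
  All.map (λ {X} (X⊆ : X ⊆ D ─ smallest a D) → disjoint-intro (λ x∈ x∈′ → ∉─ D (smallest a D) x∈ (X⊆ x∈′)))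
          (split-⊆ r _)
  ∷ split-disjoint r _

-- Refinement: every face G of Δ_c lies in a full partition of type c.  If
-- c is merged into type G by runs Rs, split each block of G accordingly.
refine-blocks : List (List ℕ) → List (Subset n) → List (List (Subset n))
refine-blocks (r ∷ Rs) (D ∷ G) = split r D ∷ refine-blocks Rs G
refine-blocks _        _       = []

refine-sizes : (Rs : List (List ℕ)) (G : List (Subset n)) → map sum Rs ≡ map ∣_∣ G →
  map (map ∣_∣) (refine-blocks Rs G) ≡ Rs
refine-sizes []       []      e = refl
refine-sizes (r ∷ Rs) (D ∷ G) e =
  cong₂ _∷_ (split-sizes r D (LP.∷-injectiveˡ e)) (refine-sizes Rs G (LP.∷-injectiveʳ e))

refine-⋃ : (Rs : List (List ℕ)) (G : List (Subset n)) → map sum Rs ≡ map ∣_∣ G →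
  map ⋃ (refine-blocks Rs G) ≡ G
refine-⋃ []       []      e = refl
refine-⋃ (r ∷ Rs) (D ∷ G) e =
  cong₂ _∷_ (split-⋃ r D (LP.∷-injectiveˡ e)) (refine-⋃ Rs G (LP.∷-injectiveʳ e))

refine-nonempty : (Rs : List (List ℕ)) (G : List (Subset n)) → All NonEmptyList Rs →
  All NonEmptyList (refine-blocks Rs G)
refine-nonempty []             G       _        = []
refine-nonempty (r ∷ Rs)       []      _        = []
refine-nonempty ((a ∷ r) ∷ Rs) (D ∷ G) (_ ∷ ne) = (smallest a D , split r _ , refl) ∷ refine-nonempty Rs G ne

refine-disjoint-from : {A : Subset n} (Rs : List (List ℕ)) (G : List (Subset n)) →
  All (Disjoint A) G → All (Disjoint A) (concat (refine-blocks Rs G))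
refine-disjoint-from []       G       _        = []
refine-disjoint-from (r ∷ Rs) []      _        = []
refine-disjoint-from (r ∷ Rs) (D ∷ G) (d ∷ ds) =
  AllP.++⁺ (All.map (λ Y⊆D → disjoint-intro (λ x∈A x∈Y → disjoint-elim d x∈A (Y⊆D x∈Y))) (split-⊆ r D))
           (refine-disjoint-from Rs G ds)

refine-disjoint : (Rs : List (List ℕ)) (G : List (Subset n)) → AllPairs Disjoint G →
  AllPairs Disjoint (concat (refine-blocks Rs G))
refine-disjoint []       G       _        = []
refine-disjoint (r ∷ Rs) []      _        = []
refine-disjoint (r ∷ Rs) (D ∷ G) (d ∷ ds) =
  APP.++⁺ (split-disjoint r D) (refine-disjoint Rs G ds)
    (All.map (λ X⊆D → All.map (λ D∩Y → disjoint-intro (λ x∈X x∈Y → disjoint-elim D∩Y (X⊆D x∈X) x∈Y))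
                              (refine-disjoint-from Rs G d))
             (split-⊆ r D))

refine : (c : List ℕ) (G : List (Subset n)) → IsOSP n G → c ≤c type G → ∃ λ H → Full c H × G ≼ H
refine {n} c G (_ , _ , _ , _ , disj , cover) (Rs , ne , refl , sizes) =
  concat LL , (refine-disjoint Rs G disj , H-cover , H-type) , LL , refine-nonempty Rs G ne , refl , refine-⋃ Rs G sizes
  where
  open ≡-Reasoning
  LL : List (List (Subset n))
  LL = refine-blocks Rs G
  H-cover : ⋃ (concat LL) ≡ ⊤
  H-cover = begin
    ⋃ (concat LL)  ≡⟨ ⋃-concat LL ⟩
    ⋃ (map ⋃ LL)   ≡⟨ cong ⋃ (refine-⋃ Rs G sizes) ⟩
    ⋃ G            ≡⟨ cover ⟩
    ⊤              ∎
  H-type : type (concat LL) ≡ concat Rs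
  H-type = begin
    map ∣_∣ (concat LL)        ≡⟨ LP.concat-map LL ⟨
    concat (map (map ∣_∣) LL)  ≡⟨ cong concat (refine-sizes Rs G sizes) ⟩
    concat Rs                  ∎

-- Full partitions are maximal faces: a face containing one has at most
-- as many blocks (c ≤c its type), so it is that partition.
full-maximal : (c : List ℕ) (F G : List (Subset n)) → Full c F → Δ[_] {n} c G → F ≼ G → G ≡ F
full-maximal c F G full (_ , c≤G) F≼G = sym (Merges-same-length ⋃-singleton F≼G G≤F)
  where
  G≤F : length G ≤ length F
  G≤F = subst₂ _≤_ (LP.length-map ∣_∣ G) (sym (length-full full)) (Merges-length c≤G)

map-∷ʳ⁻ : {A : Set} (f : A → ℕ) (F : List A) (xs : List ℕ) (y : ℕ) → map f F ≡ xs ++ [ y ] →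
  ∃ λ F₀ → ∃ λ u → F ≡ F₀ ++ [ u ] × map f F₀ ≡ xs
map-∷ʳ⁻ f (u ∷ [])     []       y e = [] , u , refl , refl
map-∷ʳ⁻ f (u ∷ v ∷ F) []       y e with LP.∷-injectiveʳ e
... | ()
map-∷ʳ⁻ f (u ∷ F)     (x ∷ xs) y e with map-∷ʳ⁻ f F xs y (LP.∷-injectiveʳ e)
... | F₀ , w , refl , e₀ = u ∷ F₀ , w , refl , cong₂ _∷_ (LP.∷-injectiveˡ e) e₀

positive⇒nonempty : (F : List (Subset n)) (cs : List ℕ) → map ∣_∣ F ≡ cs → All (1 ≤_) cs → All Nonempty F
positive⇒nonempty []      []       e _        = []
positive⇒nonempty (B ∷ F) (x ∷ cs) e (h ∷ hs) =
  1≤∣p∣⇒nonempty B (subst (1 ≤_) (sym (LP.∷-injectiveˡ e)) h) ∷ positive⇒nonempty F cs (LP.∷-injectiveʳ e) hs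

full⇒face : (cs : List ℕ) (z : ℕ) → All (1 ≤_) cs → (F : List (Subset n)) → Full (cs ++ [ z ]) F →
  Δ[_] {n} (cs ++ [ z ]) F
full⇒face cs z pos F full@(disj , cover , ty) with map-∷ʳ⁻ ∣_∣ F cs z ty
... | F₀ , u , refl , ty₀ =
  (F₀ , u , refl , positive⇒nonempty F₀ cs ty₀ pos , disj , cover) , subst ((cs ++ [ z ]) ≤c_) (sym ty) (≤c-refl _)

facet⇒full : (cs : List ℕ) (z : ℕ) → All (1 ≤_) cs → (G : List (Subset n)) →
  Facet (Δ[_] {n} (cs ++ [ z ])) G → Full (cs ++ [ z ]) G
facet⇒full cs z pos G ((osp , c≤G) , maximal) with refine (cs ++ [ z ]) G osp c≤G
... | H , full , G≼H = subst (Full (cs ++ [ z ])) (maximal H (full⇒face cs z pos H full) G≼H) full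

full⇒facet : (cs : List ℕ) (z : ℕ) → All (1 ≤_) cs → (F : List (Subset n)) → Full (cs ++ [ z ]) F →
  Facet (Δ[_] {n} (cs ++ [ z ])) F
full⇒facet cs z pos F full = full⇒face cs z pos F full , λ G G∈ F≼G → full-maximal _ F G full G∈ F≼G

merge-at : ℕ → List (Subset n) → List (Subset n)
merge-at zero    (a ∷ b ∷ xs) = ⋃ (a ∷ b ∷ []) ∷ xs
merge-at zero    xs           = xs
merge-at (suc l) []           = []
merge-at (suc l) (a ∷ xs)     = a ∷ merge-at l xs

merge-at-face : (l : ℕ) (X : List (Subset n)) → merge-at l X ≼ X
merge-at-face zero    []           = ≼-refl []
merge-at-face zero    (a ∷ [])     = ≼-refl (a ∷ [])
merge-at-face zero    (a ∷ b ∷ xs) =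
  (a ∷ b ∷ []) ∷ singletons xs , (a , b ∷ [] , refl) ∷ singletons-nonempty xs ,
  cong (λ ys → a ∷ b ∷ ys) LP.concat-map-[ xs ] , cong (_ ∷_) (map-singletons ⋃ ⋃-singleton xs)
merge-at-face (suc l) []           = ≼-refl []
merge-at-face (suc l) (a ∷ xs) with merge-at-face l xs
... | L , ne , e₁ , e₂ = [ a ] ∷ L , (a , [] , refl) ∷ ne , cong (a ∷_) e₁ , cong₂ _∷_ (⋃-singleton a) e₂

length-merge-at : (l : ℕ) (X : List (Subset n)) → suc l < length X → suc (length (merge-at l X)) ≡ length X
length-merge-at zero    (a ∷ b ∷ X) _        = refl
length-merge-at (suc l) (a ∷ X)     (s≤s lt) = cong suc (length-merge-at l X lt)
length-merge-at zero    (a ∷ [])    (s≤s ())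

merge-at-++ˡ : (l : ℕ) (R Y : List (Subset n)) → suc l < length R → merge-at l (R ++ Y) ≡ merge-at l R ++ Y
merge-at-++ˡ zero    (a ∷ b ∷ R) Y _       = refl
merge-at-++ˡ (suc l) (a ∷ R)     Y (s≤s h) = cong (a ∷_) (merge-at-++ˡ l R Y h)
merge-at-++ˡ zero    (a ∷ [])    Y (s≤s ())

merge-at-++ʳ : (k : ℕ) (R Y : List (Subset n)) → merge-at (length R + k) (R ++ Y) ≡ R ++ merge-at k Y
merge-at-++ʳ k []      Y = refl
merge-at-++ʳ k (a ∷ R) Y = cong (a ∷_) (merge-at-++ʳ k R Y)

⋃-merge-at : (l : ℕ) (R : List (Subset n)) → ⋃ (merge-at l R) ≡ ⋃ R
⋃-merge-at zero    []          = refl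
⋃-merge-at zero    (a ∷ [])    = refl
⋃-merge-at zero    (a ∷ b ∷ R) = begin
  (a ∪ (b ∪ ⊥)) ∪ ⋃ R   ≡⟨ ∪-assoc a (b ∪ ⊥) (⋃ R) ⟩
  a ∪ ((b ∪ ⊥) ∪ ⋃ R)   ≡⟨ cong (λ B → a ∪ (B ∪ ⋃ R)) (∪-identityʳ b) ⟩
  a ∪ (b ∪ ⋃ R)         ∎
  where open ≡-Reasoning
⋃-merge-at (suc l) []      = refl
⋃-merge-at (suc l) (a ∷ R) = cong (a ∪_) (⋃-merge-at l R)

merge-at-nonempty : (l : ℕ) (R : List (Subset n)) → NonEmptyList R → NonEmptyList (merge-at l R)
merge-at-nonempty zero    (a ∷ [])    _ = a , [] , refl
merge-at-nonempty zero    (a ∷ b ∷ R) _ = _ , R , refl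
merge-at-nonempty (suc l) (a ∷ R)     _ = a , merge-at l R , refl

⋃-take-++ : (k : ℕ) (R Y : List (Subset n)) → ⋃ (take (length R + k) (R ++ Y)) ≡ ⋃ R ∪ ⋃ (take k Y)
⋃-take-++ k R Y = trans (cong ⋃ (take-++ʳ k R Y)) (⋃-++ R (take k Y))

-- Let τ arise from F = concat LF and F′ = concat LF′
-- by merging runs of equal lengths.  If some x lies outside the first l+1
-- blocks of F but inside the first l+1 blocks of F′, then the cut after
-- block l falls strictly inside a run, so τ is a face of merge-at l F.
cut-inside-run : {x : Fin n} (LF LF′ : List (List (Subset n))) →
  All NonEmptyList LF → All NonEmptyList LF′ → map length LF ≡ map length LF′ → map ⋃ LF ≡ map ⋃ LF′ →
  (l : ℕ) → x ∉ ⋃ (take (suc l) (concat LF)) → x ∈ ⋃ (take (suc l) (concat LF′)) →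
  map ⋃ LF ≼ merge-at l (concat LF)
cut-inside-run [] [] _ _ _ _ l _ x∈ = ⊥-elim (∉⊥ x∈)
cut-inside-run {x = x} (R ∷ LF) (R′ ∷ LF′) (ne ∷ nes) (ne′ ∷ nes′) lens ⋃s l x∉ x∈
  with NP.<-cmp (suc l) (length R)
... | tri< inside _ _ =
  merge-at l R ∷ LF , merge-at-nonempty l R ne ∷ nes , sym (merge-at-++ˡ l R (concat LF) inside) ,
  cong (_∷ _) (⋃-merge-at l R)
... | tri≈ _ boundary _ = ⊥-elim (x∉ (subst (x ∈_) first-run x∈R′))
  where
  x∈R′ : x ∈ ⋃ R′
  x∈R′ = subst (λ T → x ∈ ⋃ T)
               (trans (cong (λ k → take k (R′ ++ concat LF′)) (trans boundary (LP.∷-injectiveˡ lens)))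
                      (take-length-++ R′ _))
               x∈
  first-run : ⋃ R′ ≡ ⋃ (take (suc l) (R ++ concat LF))
  first-run = trans (sym (LP.∷-injectiveˡ ⋃s))
                    (cong ⋃ (sym (trans (cong (λ k → take k (R ++ concat LF)) boundary) (take-length-++ R _))))
... | tri> _ _ later = subst (λ j → _ ≼ merge-at j (R ++ concat LF)) (sym l≡) later-run
  where
  k = l ∸ length R
  l≡ : l ≡ length R + k
  l≡ = sym (NP.m+[n∸m]≡n (NP.≤-pred later))
  1+l≡ : suc l ≡ length R + suc k
  1+l≡ = trans (cong suc l≡) (sym (NP.+-suc (length R) k))
  x∉′ : x ∉ ⋃ R ∪ ⋃ (take (suc k) (concat LF))
  x∉′ x∈′ = x∉ (subst (x ∈_) (sym (trans (cong (λ j → ⋃ (take j (R ++ concat LF))) 1+l≡)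
                                          (⋃-take-++ (suc k) R (concat LF))))
                          x∈′)
  x∈′ : x ∈ ⋃ R′ ∪ ⋃ (take (suc k) (concat LF′))
  x∈′ = subst (x ∈_) (trans (cong (λ j → ⋃ (take j (R′ ++ concat LF′)))
                                  (trans 1+l≡ (cong (_+ suc k) (LP.∷-injectiveˡ lens))))
                            (⋃-take-++ (suc k) R′ (concat LF′)))
              x∈
  x∈rest : x ∈ ⋃ (take (suc k) (concat LF′))
  x∈rest with x∈p∪q⁻ (⋃ R′) _ x∈′
  ... | inj₁ x∈R′ = ⊥-elim (x∉′ (x∈p∪q⁺ (inj₁ (subst (x ∈_) (sym (LP.∷-injectiveˡ ⋃s)) x∈R′))))
  ... | inj₂ x∈r  = x∈r
  later-run : map ⋃ (R ∷ LF) ≼ merge-at (length R + k) (R ++ concat LF)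
  later-run with cut-inside-run LF LF′ nes nes′ (LP.∷-injectiveʳ lens) (LP.∷-injectiveʳ ⋃s) k
                   (λ x∈r → x∉′ (x∈p∪q⁺ (inj₂ x∈r))) x∈rest
  ... | L , nes″ , e₁ , e₂ =
    R ∷ L , ne ∷ nes″ , trans (cong (R ++_) e₁) (sym (merge-at-++ʳ k R (concat LF))) , cong (⋃ R ∷_) e₂

data NoInnerZero : List ℕ → Set where
  []  : NoInnerZero []
  one : (x : ℕ) → NoInnerZero (x ∷ [])
  _∷_ : {x y : ℕ} {r : List ℕ} → 1 ≤ x → NoInnerZero (y ∷ r) → NoInnerZero (x ∷ y ∷ r)

NoInnerZero-tail : {x : ℕ} {r : List ℕ} → NoInnerZero (x ∷ r) → NoInnerZero r
NoInnerZero-tail (one _) = []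
NoInnerZero-tail (_ ∷ g) = g

NoInnerZero-suffix : (p q : List ℕ) → NoInnerZero (p ++ q) → NoInnerZero q
NoInnerZero-suffix []      q g = g
NoInnerZero-suffix (x ∷ p) q g = NoInnerZero-suffix p q (NoInnerZero-tail g)

positive-++-last : (cs : List ℕ) (z : ℕ) → All (1 ≤_) cs → NoInnerZero (cs ++ [ z ])
positive-++-last []           z _        = one z
positive-++-last (x ∷ [])     z (h ∷ _)  = h ∷ one z
positive-++-last (x ∷ y ∷ cs) z (h ∷ hs) = h ∷ positive-++-last (y ∷ cs) z hs

zero-is-last : (x : ℕ) (w : List ℕ) → NoInnerZero (x ∷ 0 ∷ w) → w ≡ []
zero-is-last x []      _               = refl
zero-is-last x (y ∷ w) (_ ∷ (() ∷ _))

singleton-vs-longer : (x y z : ℕ) (b s t : List ℕ) → NoInnerZero (y ∷ z ∷ b ++ t) →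
  x ∷ s ≡ y ∷ z ∷ b ++ t → sum [ x ] ≡ sum (y ∷ z ∷ b) → (t ≡ [] → s ≡ []) → Void
singleton-vs-longer x y z b s t g e same-sum t-last with LP.∷-injective e
... | refl , refl = contradiction
  where
  z+b≡0 : z + sum b ≡ 0
  z+b≡0 = sym (NP.+-cancelˡ-≡ x 0 (z + sum b) same-sum)
  b++t≡[] : b ++ t ≡ []
  b++t≡[] = zero-is-last x (b ++ t) (subst (λ z′ → NoInnerZero (x ∷ z′ ∷ b ++ t)) (NP.m+n≡0⇒m≡0 z z+b≡0) g)
  contradiction : Void
  contradiction with t-last (LP.++-conicalʳ b t b++t≡[])
  ... | ()

first-run-unique : (a b s t : List ℕ) → NonEmptyList a → NonEmptyList b → NoInnerZero (a ++ s) →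
  a ++ s ≡ b ++ t → sum a ≡ sum b → (s ≡ [] → t ≡ []) → (t ≡ [] → s ≡ []) → a ≡ b
first-run-unique (x ∷ [])     (y ∷ [])     s t _ _ g e _ _ _ = cong [_] (LP.∷-injectiveˡ e)
first-run-unique (x ∷ [])     (y ∷ z ∷ b) s t _ _ g e same s-last t-last =
  ⊥-elim (singleton-vs-longer x y z b s t (subst NoInnerZero e g) e same t-last)
first-run-unique (x ∷ z ∷ a) (y ∷ [])     s t _ _ g e same s-last t-last =
  ⊥-elim (singleton-vs-longer y x z a t s g (sym e) (sym same) s-last)
first-run-unique (x ∷ z ∷ a) (y ∷ w ∷ b) s t _ _ g e same s-last t-last =
  cong₂ _∷_ x≡y (first-run-unique (z ∷ a) (w ∷ b) s t (z , a , refl) (w , b , refl)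
                   (NoInnerZero-tail g) (LP.∷-injectiveʳ e) same′ s-last t-last)
  where
  x≡y : x ≡ y
  x≡y = LP.∷-injectiveˡ e
  same′ : sum (z ∷ a) ≡ sum (w ∷ b)
  same′ = NP.+-cancelˡ-≡ x _ _ (trans same (cong (_+ sum (w ∷ b)) (sym x≡y)))

concat≡[] : {A : Set} (L : List (List A)) → All NonEmptyList L → concat L ≡ [] → L ≡ []
concat≡[] []             _                  _ = refl
concat≡[] ((x ∷ r) ∷ L) ((_ , _ , refl) ∷ _) ()

map≡[] : {A B : Set} {f : A → B} (X : List A) {Y : List A} → map f X ≡ map f Y → Y ≡ [] → X ≡ []
map≡[] []      _ _    = refl
map≡[] (_ ∷ _) e refl with e
... | ()

runs-unique : (A B : List (List ℕ)) → All NonEmptyList A → All NonEmptyList B → NoInnerZero (concat A) →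
  concat A ≡ concat B → map sum A ≡ map sum B → A ≡ B
runs-unique []      []      _ _ _ _ _  = refl
runs-unique []      (b ∷ B) _ _ _ _ ()
runs-unique (a ∷ A) []      _ _ _ _ ()
runs-unique (a ∷ A) (b ∷ B) (na ∷ nas) (nb ∷ nbs) g e sums = cong₂ _∷_ a≡b (runs-unique A B nas nbs g′ e′ sums′)
  where
  sums′ : map sum A ≡ map sum B
  sums′ = LP.∷-injectiveʳ sums
  a≡b : a ≡ b
  a≡b = first-run-unique a b (concat A) (concat B) na nb g e (LP.∷-injectiveˡ sums)
          (λ A-done → cong concat (map≡[] B (sym sums′) (concat≡[] A nas A-done)))
          (λ B-done → cong concat (map≡[] A sums′ (concat≡[] B nbs B-done)))
  g′ : NoInnerZero (concat A)
  g′ = NoInnerZero-suffix a (concat A) g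
  e′ : concat A ≡ concat B
  e′ = LP.++-cancelˡ a (concat A) (concat B) (trans e (cong (_++ concat B) (sym a≡b)))

disjoint-⋃ : {B : Subset n} (R : List (Subset n)) → All (Disjoint B) R → Disjoint B (⋃ R)
disjoint-⋃ R ds = disjoint-intro λ x∈B x∈⋃R →
  let (s , s<len , x∈s) = ∈⋃⁻ R x∈⋃R in disjoint-elim (All-blk ds s s<len) x∈B x∈s

∣⋃∣ : (R : List (Subset n)) → AllPairs Disjoint R → ∣ ⋃ R ∣ ≡ sum (map ∣_∣ R)
∣⋃∣ {n} []      _        = ∣⊥∣≡0 n
∣⋃∣     (B ∷ R) (d ∷ ds) =
  trans (∣∪∣-disjoint B (⋃ R) (disjoint-⋃ R d)) (cong (λ k → ∣ B ∣ + k) (∣⋃∣ R ds))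

AllPairs-++⁻ : {A : Set} {R : A → A → Set} (xs : List A) {ys : List A} →
  AllPairs R (xs ++ ys) → AllPairs R xs × AllPairs R ys
AllPairs-++⁻ []       rs       = [] , rs
AllPairs-++⁻ (x ∷ xs) (r ∷ rs) = (AllP.++⁻ˡ xs r ∷ proj₁ (AllPairs-++⁻ xs rs)) , proj₂ (AllPairs-++⁻ xs rs)

AllPairs-concat⁻ : {A : Set} {R : A → A → Set} (LL : List (List A)) → AllPairs R (concat LL) → All (AllPairs R) LL
AllPairs-concat⁻ []       _  = []
AllPairs-concat⁻ (X ∷ LL) rs = proj₁ (AllPairs-++⁻ X rs) ∷ AllPairs-concat⁻ LL (proj₂ (AllPairs-++⁻ X rs))

run-sizes : (LF : List (List (Subset n))) → All (AllPairs Disjoint) LF →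
  map sum (map (map ∣_∣) LF) ≡ type (map ⋃ LF)
run-sizes []       _        = refl
run-sizes (R ∷ LF) (d ∷ ds) = cong₂ _∷_ (sym (∣⋃∣ R d)) (run-sizes LF ds)

map-map-nonempty : {A B : Set} (f : A → B) (LF : List (List A)) → All NonEmptyList LF →
  All NonEmptyList (map (map f) LF)
map-map-nonempty f []             []                     = []
map-map-nonempty f ((x ∷ r) ∷ LF) ((_ , _ , refl) ∷ nes) = (f x , map f r , refl) ∷ map-map-nonempty f LF nes

length-map-map : {A B : Set} (f : A → B) (LF : List (List A)) → map length (map (map f) LF) ≡ map length LF
length-map-map f LF = trans (sym (LP.map-∘ LF)) (LP.map-cong (LP.length-map f) LF)

-- Two full partitions of type c with a common face merge it by runs of
-- the same lengths: the run sizes are decompositions of c with the sums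
-- type τ, which are unique.
same-run-lengths : (c : List ℕ) → NoInnerZero c → {F F′ : List (Subset n)} → Full c F → Full c F′ →
  (LF LF′ : List (List (Subset n))) → All NonEmptyList LF → All NonEmptyList LF′ →
  concat LF ≡ F → concat LF′ ≡ F′ → map ⋃ LF ≡ map ⋃ LF′ → map length LF ≡ map length LF′
same-run-lengths c g {F} {F′} (disj , _ , ty) (disj′ , _ , ty′) LF LF′ nes nes′ refl refl same-τ = begin
  map length LF    ≡⟨ length-map-map ∣_∣ LF ⟨
  map length A     ≡⟨ cong (map length) A≡A′ ⟩
  map length A′    ≡⟨ length-map-map ∣_∣ LF′ ⟩
  map length LF′   ∎
  where
  open ≡-Reasoning
  A  = map (map ∣_∣) LF
  A′ = map (map ∣_∣) LF′
  concat-A : concat A ≡ c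
  concat-A = trans (LP.concat-map LF) ty
  concat-A′ : concat A′ ≡ c
  concat-A′ = trans (LP.concat-map LF′) ty′
  sums : map sum A ≡ map sum A′
  sums = trans (run-sizes LF (AllPairs-concat⁻ LF disj))
               (trans (cong type same-τ) (sym (run-sizes LF′ (AllPairs-concat⁻ LF′ disj′))))
  A≡A′ : A ≡ A′
  A≡A′ = runs-unique A A′ (map-map-nonempty ∣_∣ LF nes) (map-map-nonempty ∣_∣ LF′ nes′)
           (subst NoInnerZero (sym concat-A) g) (trans concat-A (sym concat-A′)) sums

common-face-merges : (c : List ℕ) → NoInnerZero c → {τ F F′ : List (Subset n)} → Full c F → Full c F′ →
  τ ≼ F → τ ≼ F′ → (l : ℕ) (x : Fin n) → x ∉ ⋃ (take (suc l) F) → x ∈ ⋃ (take (suc l) F′) →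
  τ ≼ merge-at l F
common-face-merges c g full full′ (LF , nes , refl , refl) (LF′ , nes′ , refl , same-τ) l x x∉ x∈ =
  cut-inside-run LF LF′ nes nes′ (same-run-lengths c g full full′ LF LF′ nes nes′ refl refl (sym same-τ))
    (sym same-τ) l x∉ x∈

first-difference : {X Y : List (Subset n)} → X <L Y →
  ∃ λ p → (∀ s → s < p → blk X s ≡ blk Y s) × blk X p <S blk Y p
first-difference (here h) = zero , (λ s ()) , h
first-difference {X = a ∷ X} (there h) with first-difference h
... | p , same , h′ = suc p , same′ , h′
  where
  same′ : ∀ s → s < suc p → blk (a ∷ X) s ≡ blk (a ∷ _) s
  same′ zero    _       = refl
  same′ (suc s) (s≤s h) = same s h

first-difference⇒<L : (p : ℕ) (X Y : List (Subset n)) → (∀ s → s < p → blk X s ≡ blk Y s) →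
  blk X p <S blk Y p → p < length X → p < length Y → X <L Y
first-difference⇒<L zero    (a ∷ X) (b ∷ Y) _    h _        _        = here h
first-difference⇒<L (suc p) (a ∷ X) (b ∷ Y) same h (s≤s lx) (s≤s ly) with same zero (s≤s z≤n)
... | refl = there (first-difference⇒<L p X Y (λ s lt → same (suc s) (s≤s lt)) h lx ly)

least-difference : {P Q : Subset n} → P <S Q →
  ∃ λ x → x ∈ P × x ∉ Q × (∀ y → y Fin.< x → y ∈ Q → y ∈ P)
least-difference here = zero , here , (λ ()) , (λ y ())
least-difference (there h) with least-difference h
... | x , x∈P , x∉Q , below = suc x , there x∈P , (λ { (there x∈Q) → x∉Q x∈Q }) , below′
  where
  below′ : ∀ y → y Fin.< suc x → y ∈ _ → y ∈ _
  below′ zero    _        here       = here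
  below′ (suc y) (s≤s lt) (there y∈) = there (below y lt y∈)

<S-at : (b : Fin n) (P Q : Subset n) → (∀ y → y Fin.< b → lookup P y ≡ lookup Q y) →
  lookup P b ≡ true → lookup Q b ≡ false → P <S Q
<S-at zero    (true ∷ P) (false ∷ Q) _    _  _  = here
<S-at (suc b) (u ∷ P)    (v ∷ Q)     same e₁ e₂ with same zero (s≤s z≤n)
... | refl = there (<S-at b P Q (λ y lt → same (suc y) (s≤s lt)) e₁ e₂)

larger-element : {P Q : Subset n} → ∣ Q ∣ ≡ ∣ P ∣ → (x : Fin n) → x ∈ P → x ∉ Q →
  (∀ y → y Fin.< x → y ∈ Q → y ∈ P) → ∃ λ y → y ∈ Q × x Fin.< y
larger-element {P = P} {Q} same-size x x∈P x∉Q below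
  with FP.any? (λ y → (y ∈? Q) ×-dec (x FP.<? y))
... | yes found = found
... | no none   = ⊥-elim (NP.<-irrefl same-size (p⊂q⇒∣p∣<∣q∣ (Q⊆P , x , x∈P , x∉Q)))
  where
  Q⊆P : Q ⊆ P
  Q⊆P {y} y∈Q with FP.<-cmp y x
  ... | tri< y<x _ _ = below y y<x y∈Q
  ... | tri≈ _ y≡x _ = ⊥-elim (x∉Q (subst (_∈ Q) y≡x y∈Q))
  ... | tri> _ _ x<y = ⊥-elim (none (y , y∈Q , x<y))

Descent : List (Subset n) → ℕ → Set
Descent {n} F l = ∃ λ (a : Fin n) → ∃ λ (b : Fin n) → a ∈ blk F l × b ∈ blk F (suc l) × b Fin.< a

find-descent : (F : List (Subset n)) → BlocksDisjoint F → (x : Fin n) (t : ℕ) → x ∈ blk F t →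
  (∀ s → s < t → Nonempty (blk F s)) → ∀ d p (y : Fin n) → t ≡ p + suc d → y ∈ blk F p → x Fin.< y →
  ∃ λ l → p ≤ l × l < t × Descent F l
find-descent F bd x t x∈t nonempty zero p y refl y∈p x<y =
  p , NP.≤-refl , NP.m<m+n p (s≤s z≤n) , y , x , y∈p , subst (λ k → x ∈ blk F k) (NP.+-comm p 1) x∈t , x<y
find-descent F bd x t x∈t nonempty (suc d) p y refl y∈p x<y
  with nonempty (suc p) (subst (suc p <_) (sym (NP.+-suc p (suc d))) (s≤s (NP.m<m+n p (s≤s z≤n))))
... | w , w∈ with FP.<-cmp w y
... | tri< w<y _ _ = p , NP.≤-refl , NP.m<m+n p (s≤s z≤n) , y , w , y∈p , w∈ , w<y
... | tri≈ _ w≡y _ = ⊥-elim (NP.1+n≢n (sym (bd p (suc p) y∈p (subst (λ v → v ∈ blk F (suc p)) w≡y w∈))))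
... | tri> _ _ y<w with find-descent F bd x t x∈t nonempty d (suc p) w (NP.+-suc p (suc d)) w∈ (FP.<-trans x<y y<w)
... | l , 1+p≤l , l<t , descent = l , NP.≤-trans (NP.n≤1+n p) 1+p≤l , l<t , descent

entry-positive : (cs : List ℕ) (z : ℕ) → All (1 ≤_) cs → (s : ℕ) → s < length cs → 1 ≤ entry (cs ++ [ z ]) s
entry-positive (x ∷ cs) z (h ∷ _)  zero    _        = h
entry-positive (x ∷ cs) z (_ ∷ hs) (suc s) (s≤s lt) = entry-positive cs z hs s lt

inner-blocks-nonempty : (cs : List ℕ) (z : ℕ) → All (1 ≤_) cs → (F : List (Subset n)) →
  Full (cs ++ [ z ]) F → (s : ℕ) → suc s < length F → Nonempty (blk F s)
inner-blocks-nonempty cs z pos F full@(_ , _ , ty) s 1+s<len =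
  1≤∣p∣⇒nonempty (blk F s) (subst (1 ≤_) (sym (trans (∣blk∣ F s) (cong (λ d → entry d s) ty)))
                                   (entry-positive cs z pos s (NP.≤-pred (subst (suc s <_) len≡ 1+s<len))))
  where
  len≡ : length F ≡ suc (length cs)
  len≡ = trans (length-full full) (trans (LP.length-++ cs) (NP.+-comm (length cs) 1))

-- Take the first differing block p and its least differing
-- element x (in F′ block p, in F a later block t); block p of F contains
-- some y > x, and walking from y to x in F gives the descent.
separating-descent : (cs : List ℕ) (z : ℕ) → All (1 ≤_) cs → (F F′ : List (Subset n)) →
  Full (cs ++ [ z ]) F → Full (cs ++ [ z ]) F′ → F′ <L F →
  ∃ λ l → suc l < length F × Descent F l × ∃ λ x → x ∉ ⋃ (take (suc l) F) × x ∈ ⋃ (take (suc l) F′)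
separating-descent {n} cs z pos F F′ full@(disj , cover , ty) (disj′ , _ , ty′) F′<F =
  l , NP.<-≤-trans (s≤s l<t) t<len , descent , x , x∉ , x∈
  where
  bd : BlocksDisjoint F
  bd  = AllPairs⇒BlocksDisjoint disj
  bd′ : BlocksDisjoint F′
  bd′ = AllPairs⇒BlocksDisjoint disj′
  difference : ∃ λ p → (∀ s → s < p → blk F′ s ≡ blk F s) × blk F′ p <S blk F p
  difference = first-difference F′<F
  p : ℕ
  p = proj₁ difference
  same-before : ∀ s → s < p → blk F′ s ≡ blk F s
  same-before = proj₁ (proj₂ difference)
  least : ∃ λ x → x ∈ blk F′ p × x ∉ blk F p × (∀ y → y Fin.< x → y ∈ blk F p → y ∈ blk F′ p)
  least = least-difference (proj₂ (proj₂ difference))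
  x : Fin n
  x = proj₁ least
  x∈F′p : x ∈ blk F′ p
  x∈F′p = proj₁ (proj₂ least)
  x∉Fp : x ∉ blk F p
  x∉Fp = proj₁ (proj₂ (proj₂ least))
  same-size : ∣ blk F p ∣ ≡ ∣ blk F′ p ∣
  same-size = trans (∣blk∣ F p) (trans (cong (λ d → entry d p) (trans ty (sym ty′))) (sym (∣blk∣ F′ p)))
  larger : ∃ λ y → y ∈ blk F p × x Fin.< y
  larger = larger-element same-size x x∈F′p x∉Fp (proj₂ (proj₂ (proj₂ least)))
  x-block : ∃ λ s → s < length F × x ∈ blk F s
  x-block = cover-blk F cover x
  t : ℕ
  t = proj₁ x-block
  t<len : t < length F
  t<len = proj₁ (proj₂ x-block)
  x∈Ft : x ∈ blk F t
  x∈Ft = proj₂ (proj₂ x-block)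
  p<t : p < t
  p<t with NP.<-cmp p t
  ... | tri< p<t _ _ = p<t
  ... | tri≈ _ p≡t _ = ⊥-elim (x∉Fp (subst (λ k → x ∈ blk F k) (sym p≡t) x∈Ft))
  ... | tri> _ _ t<p = ⊥-elim (NP.<-irrefl (bd′ t p (subst (x ∈_) (sym (same-before t t<p)) x∈Ft) x∈F′p) t<p)
  t≡ : t ≡ p + suc (t ∸ suc p)
  t≡ = trans (sym (NP.m+[n∸m]≡n p<t)) (sym (NP.+-suc p (t ∸ suc p)))
  walk : ∃ λ l → p ≤ l × l < t × Descent F l
  walk = find-descent F bd x t x∈Ft (λ s s<t → inner-blocks-nonempty cs z pos F full s (NP.<-≤-trans (s≤s s<t) t<len))
                      (t ∸ suc p) p (proj₁ larger) t≡ (proj₁ (proj₂ larger)) (proj₂ (proj₂ larger))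
  l : ℕ
  l = proj₁ walk
  p≤l : p ≤ l
  p≤l = proj₁ (proj₂ walk)
  l<t : l < t
  l<t = proj₁ (proj₂ (proj₂ walk))
  descent : Descent F l
  descent = proj₂ (proj₂ (proj₂ walk))
  x∉ : x ∉ ⋃ (take (suc l) F)
  x∉ x∈ with ∈⋃-take⁻ (suc l) F x∈
  ... | s , s≤l , x∈s = NP.<-irrefl (bd s t x∈s x∈Ft) (NP.≤-<-trans (NP.≤-pred s≤l) l<t)
  x∈ : x ∈ ⋃ (take (suc l) F′)
  x∈ = ∈⋃⁺ (take (suc l) F′) p (subst (x ∈_) (sym (take-blk (suc l) p F′ (s≤s p≤l))) x∈F′p)

∣set-true∣ : (i : Fin n) (X : Subset n) → lookup X i ≡ false → ∣ X [ i ]≔ true ∣ ≡ suc ∣ X ∣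
∣set-true∣ zero    (false ∷ X) _ = refl
∣set-true∣ (suc i) (true ∷ X)  e = cong suc (∣set-true∣ i X e)
∣set-true∣ (suc i) (false ∷ X) e = ∣set-true∣ i X e

∣set-false∣ : (i : Fin n) (X : Subset n) → lookup X i ≡ true → suc ∣ X [ i ]≔ false ∣ ≡ ∣ X ∣
∣set-false∣ zero    (true ∷ X)  _ = refl
∣set-false∣ (suc i) (true ∷ X)  e = cong suc (∣set-false∣ i X e)
∣set-false∣ (suc i) (false ∷ X) e = ∣set-false∣ i X e

blk-map : (f : Subset n → Subset n) (F : List (Subset n)) (s : ℕ) → s < length F → blk (map f F) s ≡ f (blk F s)
blk-map f (B ∷ F) zero    _        = refl
blk-map f (B ∷ F) (suc s) (s≤s lt) = blk-map f F s lt

module Exchange (a b : Fin n) (a≢b : a ≢ b) where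

  exchange : Subset n → Subset n
  exchange B = (B [ a ]≔ lookup B b) [ b ]≔ lookup B a

  b≢a : b ≢ a
  b≢a b≡a = a≢b (sym b≡a)

  lookup-exchange-a : (B : Subset n) → lookup (exchange B) a ≡ lookup B b
  lookup-exchange-a B =
    trans (VP.lookup∘update′ a≢b (B [ a ]≔ lookup B b) (lookup B a)) (VP.lookup∘update a B (lookup B b))

  lookup-exchange-b : (B : Subset n) → lookup (exchange B) b ≡ lookup B a
  lookup-exchange-b B = VP.lookup∘update b (B [ a ]≔ lookup B b) (lookup B a)

  lookup-exchange-other : (B : Subset n) (y : Fin n) → y ≢ a → y ≢ b → lookup (exchange B) y ≡ lookup B y
  lookup-exchange-other B y y≢a y≢b =
    trans (VP.lookup∘update′ y≢b (B [ a ]≔ lookup B b) (lookup B a)) (VP.lookup∘update′ y≢a B (lookup B b))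

  Balanced : Subset n → Set
  Balanced B = lookup B a ≡ lookup B b

  exchange-balanced : (B : Subset n) → Balanced B → exchange B ≡ B
  exchange-balanced B bal = subset-ext pointwise
    where
    pointwise : ∀ y → lookup (exchange B) y ≡ lookup B y
    pointwise y with y FP.≟ a | y FP.≟ b
    ... | yes refl | _        = trans (lookup-exchange-a B) (sym bal)
    ... | no _     | yes refl = trans (lookup-exchange-b B) bal
    ... | no y≢a   | no y≢b   = lookup-exchange-other B y y≢a y≢b

  absent-balanced : {B : Subset n} → a ∉ B → b ∉ B → Balanced B
  absent-balanced a∉B b∉B = trans (∉⇒lookup a∉B) (sym (∉⇒lookup b∉B))

  exchange-⊥ : exchange ⊥ ≡ ⊥
  exchange-⊥ = exchange-balanced ⊥ (absent-balanced ∉⊥ ∉⊥)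

  exchange-zipWith : (f : Bool → Bool → Bool) (A B : Subset n) →
    exchange (V.zipWith f A B) ≡ V.zipWith f (exchange A) (exchange B)
  exchange-zipWith f A B = subset-ext pointwise
    where
    open ≡-Reasoning
    Z : Subset n → Subset n → Subset n
    Z = V.zipWith f
    pointwise : ∀ y → lookup (exchange (Z A B)) y ≡ lookup (Z (exchange A) (exchange B)) y
    pointwise y with y FP.≟ a | y FP.≟ b
    ... | yes refl | _ = begin
      lookup (exchange (Z A B)) a                  ≡⟨ lookup-exchange-a (Z A B) ⟩
      lookup (Z A B) b                             ≡⟨ VP.lookup-zipWith f b A B ⟩
      f (lookup A b) (lookup B b)                  ≡⟨ cong₂ f (lookup-exchange-a A) (lookup-exchange-a B) ⟨
      f (lookup (exchange A) a) (lookup (exchange B) a) ≡⟨ VP.lookup-zipWith f a (exchange A) (exchange B) ⟨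
      lookup (Z (exchange A) (exchange B)) a       ∎
    ... | no _ | yes refl = begin
      lookup (exchange (Z A B)) b                  ≡⟨ lookup-exchange-b (Z A B) ⟩
      lookup (Z A B) a                             ≡⟨ VP.lookup-zipWith f a A B ⟩
      f (lookup A a) (lookup B a)                  ≡⟨ cong₂ f (lookup-exchange-b A) (lookup-exchange-b B) ⟨
      f (lookup (exchange A) b) (lookup (exchange B) b) ≡⟨ VP.lookup-zipWith f b (exchange A) (exchange B) ⟨
      lookup (Z (exchange A) (exchange B)) b       ∎
    ... | no y≢a | no y≢b = begin
      lookup (exchange (Z A B)) y                  ≡⟨ lookup-exchange-other (Z A B) y y≢a y≢b ⟩
      lookup (Z A B) y                             ≡⟨ VP.lookup-zipWith f y A B ⟩
      f (lookup A y) (lookup B y)                  ≡⟨ cong₂ f (lookup-exchange-other A y y≢a y≢b)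
                                                              (lookup-exchange-other B y y≢a y≢b) ⟨
      f (lookup (exchange A) y) (lookup (exchange B) y) ≡⟨ VP.lookup-zipWith f y (exchange A) (exchange B) ⟨
      lookup (Z (exchange A) (exchange B)) y       ∎

  -- Exchange preserves sizes: if the two bits differ, one is cleared and the
  -- other one set.
  ∣exchange∣ : (B : Subset n) → ∣ exchange B ∣ ≡ ∣ B ∣
  ∣exchange∣ B = by-bits (lookup B a) (lookup B b) refl refl
    where
    open ≡-Reasoning
    by-bits : (u v : Bool) → lookup B a ≡ u → lookup B b ≡ v → ∣ exchange B ∣ ≡ ∣ B ∣
    by-bits true  true  eqa eqb = cong ∣_∣ (exchange-balanced B (trans eqa (sym eqb)))
    by-bits false false eqa eqb = cong ∣_∣ (exchange-balanced B (trans eqa (sym eqb)))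
    by-bits true  false eqa eqb rewrite eqa | eqb =
      trans (∣set-true∣ b (B [ a ]≔ false) (trans (VP.lookup∘update′ b≢a B false) eqb)) (∣set-false∣ a B eqa)
    by-bits false true  eqa eqb rewrite eqa | eqb = NP.suc-injective (begin
      suc ∣ (B [ a ]≔ true) [ b ]≔ false ∣  ≡⟨ ∣set-false∣ b (B [ a ]≔ true) (trans (VP.lookup∘update′ b≢a B true) eqb) ⟩
      ∣ B [ a ]≔ true ∣                    ≡⟨ ∣set-true∣ a B eqa ⟩
      suc ∣ B ∣                            ∎)

  exchange-∪ : (A B : Subset n) → exchange (A ∪ B) ≡ exchange A ∪ exchange B
  exchange-∪ = exchange-zipWith _∨_

  exchange-⋃ : (F : List (Subset n)) → exchange (⋃ F) ≡ ⋃ (map exchange F)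
  exchange-⋃ []      = exchange-⊥
  exchange-⋃ (B ∷ F) = trans (exchange-∪ B (⋃ F)) (cong (exchange B ∪_) (exchange-⋃ F))

  exchange-disjoint : {A B : Subset n} → Disjoint A B → Disjoint (exchange A) (exchange B)
  exchange-disjoint {A} {B} d (x , x∈) = ∉⊥ (subst (x ∈_) A∩B-image x∈)
    where
    A∩B-image : exchange A ∩ exchange B ≡ ⊥
    A∩B-image = trans (sym (exchange-zipWith B._∧_ A B)) (trans (cong exchange (Empty-unique d)) exchange-⊥)

  exchange-full : {c : List ℕ} {F : List (Subset n)} → Full c F → Full c (map exchange F)
  exchange-full {F = F} (disj , cover , ty) =
    APP.map⁺ (AP.map exchange-disjoint disj) ,
    trans (sym (exchange-⋃ F)) (trans (cong exchange cover) (exchange-balanced ⊤ ⊤-balanced)) ,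
    trans (sym (LP.map-∘ F)) (trans (LP.map-cong ∣exchange∣ F) ty)
    where
    ⊤-balanced : Balanced ⊤
    ⊤-balanced = trans (∈⇒lookup (∈⊤ {x = a})) (sym (∈⇒lookup (∈⊤ {x = b})))

  map-exchange-balanced : (Y : List (Subset n)) → All Balanced Y → map exchange Y ≡ Y
  map-exchange-balanced []      []           = refl
  map-exchange-balanced (B ∷ Y) (bal ∷ bals) = cong₂ _∷_ (exchange-balanced B bal) (map-exchange-balanced Y bals)

merge-at-map : (f : Subset n → Subset n) → (∀ A B → f (⋃ (A ∷ B ∷ [])) ≡ ⋃ (f A ∷ f B ∷ [])) →
  (l : ℕ) (X : List (Subset n)) → merge-at l (map f X) ≡ map f (merge-at l X)
merge-at-map f f-⋃ zero    []           = refl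
merge-at-map f f-⋃ zero    (A ∷ [])     = refl
merge-at-map f f-⋃ zero    (A ∷ B ∷ X)  = cong (_∷ map f X) (sym (f-⋃ A B))
merge-at-map f f-⋃ (suc l) []           = refl
merge-at-map f f-⋃ (suc l) (A ∷ X)      = cong (f A ∷_) (merge-at-map f f-⋃ l X)

-- The exchange at a descent a ∈ F_l, b ∈ F_{l+1}, b < a of a partition F:
-- it yields a lexicographically smaller partition with the same merge at l.
module DescentExchange (F : List (Subset n)) (bd : BlocksDisjoint F) (l : ℕ) (a b : Fin n)
                       (a∈ : a ∈ blk F l) (b∈ : b ∈ blk F (suc l)) (b<a : b Fin.< a) where

  a≢b : a ≢ b
  a≢b a≡b = FP.<⇒≢ b<a (sym a≡b)

  open Exchange a b a≢b public

  l<len : l < length F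
  l<len = blk-in-range F l a∈

  other-balanced : (s : ℕ) → s ≢ l → s ≢ suc l → Balanced (blk F s)
  other-balanced s s≢l s≢1+l =
    absent-balanced (λ a∈s → s≢l (bd s l a∈s a∈)) (λ b∈s → s≢1+l (bd s (suc l) b∈s b∈))

  -- The exchanged partition is lexicographically smaller: the blocks before l
  -- contain neither point, and block l gains b < a in place of a.
  exchange-earlier : map exchange F <L F
  exchange-earlier =
    first-difference⇒<L l (map exchange F) F same-before at-l
                        (subst (l <_) (sym (LP.length-map exchange F)) l<len) l<len
    where
    same-before : ∀ s → s < l → blk (map exchange F) s ≡ blk F s
    same-before s s<l = trans (blk-map exchange F s (NP.<-trans s<l l<len))
                              (exchange-balanced _ (other-balanced s (NP.<⇒≢ s<l) (NP.<⇒≢ (NP.m<n⇒m<1+n s<l))))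
    b∉Fl : b ∉ blk F l
    b∉Fl b∈l = NP.1+n≢n (sym (bd l (suc l) b∈l b∈))
    agree-below : ∀ y → y Fin.< b → lookup (exchange (blk F l)) y ≡ lookup (blk F l) y
    agree-below y y<b = lookup-exchange-other (blk F l) y (FP.<⇒≢ (FP.<-trans y<b b<a)) (FP.<⇒≢ y<b)
    at-l : blk (map exchange F) l <S blk F l
    at-l = subst (_<S blk F l) (sym (blk-map exchange F l l<len))
             (<S-at b (exchange (blk F l)) (blk F l) agree-below
                    (trans (lookup-exchange-b (blk F l)) (∈⇒lookup a∈)) (∉⇒lookup b∉Fl))

  -- Every block of merge-at l F is balanced: the merged block contains both
  -- points, the others neither.
  merged-balanced : (k : ℕ) (X : List (Subset n)) → BlocksDisjoint X → a ∈ blk X k → b ∈ blk X (suc k) →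
    All Balanced (merge-at k X)
  merged-balanced zero    []          _   a∈X _   = ⊥-elim (∉⊥ a∈X)
  merged-balanced zero    (A ∷ [])    _   _   b∈X = ⊥-elim (∉⊥ b∈X)
  merged-balanced zero    (A ∷ B ∷ X) bdX a∈A b∈B =
    trans (∈⇒lookup {p = ⋃ (A ∷ B ∷ [])} (x∈p∪q⁺ (inj₁ a∈A)))
          (sym (∈⇒lookup {p = ⋃ (A ∷ B ∷ [])} (x∈p∪q⁺ (inj₂ (x∈p∪q⁺ (inj₁ b∈B)))))) ∷
    All-from-blk X (λ s _ → absent-balanced (λ a∈s → NP.0≢1+n (bdX 0 (suc (suc s)) a∈A a∈s))
                                            (λ b∈s → NP.0≢1+n (NP.suc-injective (bdX 1 (suc (suc s)) b∈B b∈s))))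
  merged-balanced (suc k) []          _   a∈X _   = ⊥-elim (∉⊥ a∈X)
  merged-balanced (suc k) (A ∷ X)     bdX a∈X b∈X =
    absent-balanced (λ a∈A → NP.0≢1+n (bdX 0 (suc k) a∈A a∈X)) (λ b∈A → NP.0≢1+n (bdX 0 (suc (suc k)) b∈A b∈X)) ∷
    merged-balanced k X (λ s s′ x∈ x∈′ → NP.suc-injective (bdX (suc s) (suc s′) x∈ x∈′)) a∈X b∈X

  -- It has the same merge at l, since every block of that merge is balanced.
  exchange-merge : merge-at l (map exchange F) ≡ merge-at l F
  exchange-merge = trans (merge-at-map exchange exchange-⋃-pair l F)
                         (map-exchange-balanced (merge-at l F) (merged-balanced l F bd a∈ b∈))
    where
    exchange-⋃-pair : ∀ A B → exchange (⋃ (A ∷ B ∷ [])) ≡ ⋃ (exchange A ∷ exchange B ∷ [])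
    exchange-⋃-pair A B = exchange-⋃ (A ∷ B ∷ [])

dim-one-less : (τ F : List (Subset n)) → suc (length τ) ≡ length F → dim τ ≡ dim F - + 1
dim-one-less τ F len≡ = trans (shift (+ length τ)) (cong (λ k → + k - + 2 - + 1) len≡)
  where
  shift : (k : ℤ) → k - + 2 ≡ (+ 1 +ℤ k - + 2) - + 1
  shift = solve-∀

module Shelling (cs : List ℕ) (z : ℕ) (pos : All (1 ≤_) cs) where

  c : List ℕ
  c = cs ++ [ z ]

  facets : List (List (Subset n))
  facets = full-partitions c

  facet : Fin (length (facets {n})) → List (Subset n)
  facet = L.lookup facets

  facet-full : (i : Fin (length (facets {n}))) → Full c (facet i)
  facet-full = full-partitions-full c

  facet-order : (i j : Fin (length (facets {n}))) → toℕ i < toℕ j → facet i <L facet j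
  facet-order = AllPairs-lookup (full-partitions-sorted c)

  facet-injective : (i j : Fin (length (facets {n}))) → facet i ≡ facet j → i ≡ j
  facet-injective i j e with FP.<-cmp i j
  ... | tri< i<j _ _ = ⊥-elim (<L-irrefl (subst (_<L facet j) e (facet-order i j i<j)))
  ... | tri≈ _ i≡j _ = i≡j
  ... | tri> _ _ j<i = ⊥-elim (<L-irrefl (subst (facet j <L_) e (facet-order j i j<i)))

  earlier-facet : (i : Fin (length (facets {n}))) (G : List (Subset n)) → Full c G → G <L facet i →
    ∃ λ j → toℕ j < toℕ i × facet j ≡ G
  earlier-facet i G full G<Fi with full-partitions-complete c G full
  ... | j , refl with FP.<-cmp j i
  ...   | tri< j<i _ _ = j , j<i , refl
  ...   | tri≈ _ refl _ = ⊥-elim (<L-irrefl G<Fi)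
  ...   | tri> _ _ i<j = ⊥-elim (<L-asym (facet-order i j i<j) G<Fi)

  -- Shelling condition: a maximal face τ of F_i ∩ (F_1 ∪ … ∪ F_{i-1}) lies
  -- in some earlier F_j; the separating descent of F_i at a cut l gives
  -- τ ≼ merge-at l F_i, and exchanging the descent shows that this ridge
  -- lies in an earlier facet too, so τ is that ridge.
  ridge : (i : Fin (length (facets {n}))) → PureOfDim (ShellInter facet i) (dim (facet i) - + 1)
  ridge {n} i τ ((τ≼F , j , j<i , τ≼Fj) , maximal) =
    ridge-at (separating-descent cs z pos (facet i) (facet j) (facet-full i) (facet-full j) (facet-order j i j<i))
    where
    F : List (Subset n)
    F = facet i
    ridge-at : (∃ λ l → suc l < length F × Descent F l ×
                 ∃ λ x → x ∉ ⋃ (take (suc l) F) × x ∈ ⋃ (take (suc l) (facet j))) →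
               dim τ ≡ dim F - + 1
    ridge-at (l , l+1<len , (a , b , a∈ , b∈ , b<a) , x , x∉ , x∈) =
      trans (cong dim (sym τ≡M)) (dim-one-less M F (length-merge-at l F l+1<len))
      where
      M : List (Subset n)
      M = merge-at l F
      open DescentExchange F (AllPairs⇒BlocksDisjoint (proj₁ (facet-full i))) l a b a∈ b∈ b<a
      τ≼M : τ ≼ M
      τ≼M = common-face-merges c (positive-++-last cs z pos) (facet-full i) (facet-full j) τ≼F τ≼Fj l x x∉ x∈
      exchanged : ∃ λ j′ → toℕ j′ < toℕ i × facet j′ ≡ map exchange F
      exchanged = earlier-facet i (map exchange F) (exchange-full (facet-full i)) exchange-earlier
      M-in-earlier : M ≼ facet (proj₁ exchanged)
      M-in-earlier = subst₂ _≼_ exchange-merge (sym (proj₂ (proj₂ exchanged))) (merge-at-face l (map exchange F))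
      τ≡M : M ≡ τ
      τ≡M = maximal M (merge-at-face l F , proj₁ exchanged , proj₁ (proj₂ exchanged) , M-in-earlier) τ≼M

  shellable : Shellable (Δ[_] {n} c)
  shellable = (+ length c - + 2 , pure) , inj₂ (length facets , facet , is-facet , complete , facet-injective , λ i _ → ridge i)
    where
    pure : PureOfDim (Δ[_] {n} c) (+ length c - + 2)
    pure F F-facet = cong (λ k → + k - + 2) (length-full (facet⇒full cs z pos F F-facet))
    is-facet : ∀ i → Facet (Δ[_] {n} c) (facet i)
    is-facet i = full⇒facet cs z pos (facet i) (facet-full i)
    complete : ∀ G → Facet (Δ[_] {n} c) G → ∃ λ i → facet i ≡ G
    complete G G-facet = full-partitions-complete c G (facet⇒full cs z pos G G-facet)

corollary4p3 : (n : ℕ) (c : List ℕ) → IsPointedComposition n c → last c ≡ just 0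
    → Shellable (Δ[_] {n} c)
corollary4p3 n c (cs , ck , refl , pos , _) _ = Shelling.shellable cs ck pos
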